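{- For every finite bipartite graph $G$ there is a monotone CNF-formula $F$ whose incidence graph is $G$ (up to isomorphism) and such that $\mathbf{psw}(F)\ge 2^{\mathbf{mimw}(G)/2}$.
   Context: A CNF-formula is monotone if all variables occur only positively. The incidence graph $I(F)$ is the bipartite graph on $\mathrm{var}(F)\cup\mathrm{cla}(F)$ with edge $xC$ iff $x$ occurs in $C$. A branch decomposition $(T,\delta)$ of a graph $G$ is a rooted tree $T$ with all degrees at most $3$ and a bijection $\delta$ from the leaves of $T$ to $V(G)$; each node $t$ yields the cut $(A,\bar A)$ with $A$ the vertices labelling leaves below $t$. $G[A,\bar A]$ is the graph on $V(G)$ with only the edges of $G$ between $A$ and $\bar A$. The MIM-width of $(T,\delta)$ is the maximum over nodes of the maximum induced matching size in $G[A,\bar A]$; $\mathbf{mimw}(G)$ is the minimum MIM-width over all branch decompositions of $G$. A set $\mathcal C\subseteq\mathrm{cla}(F)$ is precisely satisfiable if some assignment satisfies all clauses in $\mathcal C$ and none in $\mathrm{cla}(F)\setminus\mathcal C$; the PS-value of $F$ is the number of precisely satisfiable sets. $F_{X,\mathcal C}$ is obtained by deleting all clauses not in $\mathcal C$ and then all variables not in $X$. For a cut $(A,\bar A)$ of $I(F)$, with $X=\mathrm{var}(F)\cap A$, $\bar X=\mathrm{var}(F)\cap\bar A$, $\mathcal C=\mathrm{cla}(F)\cap A$, $\bar{\mathcal C}=\mathrm{cla}(F)\cap\bar A$, let $ps(A,\bar A)$ be the maximum of the PS-values of $F_{X,\bar{\mathcal C}}$ and $F_{\bar X,\mathcal C}$.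 The PS-width of a branch decomposition of $I(F)$ is the maximum of $ps$ over its cuts; $\mathbf{psw}(F)$ is the minimum over branch decompositions of $I(F)$. -}

module Defs where

open import Data.Nat using (ℕ; zero; suc; _+_; _≤_; _⊔_)
open import Data.Bool using (Bool; true; false; _∧_; _∨_; not; if_then_else_; T)
open import Data.Fin using (Fin; splitAt; _↑ˡ_; _↑ʳ_)
import Data.Fin as Fin
open import Data.List using (List; []; _∷_; _++_; map; length; allFin; concatMap; foldr; lookup)
open import Data.Bool.ListAction using (any; all)
open import Data.List.Membership.Propositional using (_∈_)
open import Data.List.Relation.Unary.All using (All)
open import Data.Product using (Σ; ∃; _×_; _,_; proj₁; proj₂)
open import Data.Sum using (_⊎_; inj₁; inj₂)
open import Relation.Nullary using (¬_; does)
open import Relation.Binary.PropositionalEquality using (_≡_; _≢_)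
open import Function.Bundles using (_↔_; Inverse)

consB : ∀ {n} → Bool → (Fin n → Bool) → Fin (suc n) → Bool
consB b f Fin.zero    = b
consB b f (Fin.suc i) = f i

allFuns : ∀ n → List (Fin n → Bool)
allFuns zero    = (λ ()) ∷ []
allFuns (suc n) = concatMap (λ f → consB false f ∷ consB true f ∷ []) (allFuns n)

count : ∀ {A : Set} → (A → Bool) → List A → ℕ
count p []       = 0
count p (x ∷ xs) = if p x then suc (count p xs) else count p xs

eqB : Bool → Bool → Bool
eqB a b = if a then b else not b

_⇒B_ : Bool → Bool → Bool
a ⇒B b = not a ∨ b

record Graph : Set where
  field
    n   : ℕ
    adj : Fin n → Fin n → Bool
open Graph public

IsSimple : Graph → Set
IsSimple G = (∀ u v → adj G u v ≡ adj G v u) × (∀ u → adj G u u ≡ false)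

IsBipartite : Graph → Set
IsBipartite G = Σ (Fin (n G) → Bool) λ c → ∀ u v → T (adj G u v) → c u ≢ c v

_≅_ : Graph → Graph → Set
G ≅ H = Σ (Fin (n G) ↔ Fin (n H)) λ f →
          ∀ u v → adj G u v ≡ adj H (Inverse.to f u) (Inverse.to f v)

-- CNF formulas: variables Fin nv, clauses Fin nc;
-- pos C x : x occurs positively in C, neg C x : x occurs negatively in C.

record CNF : Set where
  field
    nv  : ℕ
    nc  : ℕ
    pos : Fin nc → Fin nv → Bool
    neg : Fin nc → Fin nv → Bool
open CNF public

Monotone : CNF → Set
Monotone F = ∀ C x → neg F C x ≡ false

occurs : (F : CNF) → Fin (nc F) → Fin (nv F) → Bool
occurs F C x = pos F C x ∨ neg F C x

-- incidence graph: vertices Fin (nv + nc); x ↑ˡ nc is variable x, nv ↑ʳ C is clause C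
incAdj : (F : CNF) → Fin (nv F) ⊎ Fin (nc F) → Fin (nv F) ⊎ Fin (nc F) → Bool
incAdj F (inj₁ x) (inj₂ C) = occurs F C x
incAdj F (inj₂ C) (inj₁ x) = occurs F C x
incAdj F _        _        = false

incidence : CNF → Graph
incidence F = record
  { n   = nv F + nc F
  ; adj = λ u v → incAdj F (splitAt (nv F) u) (splitAt (nv F) v) }

litTrue : (F : CNF) → (Fin (nv F) → Bool) → Fin (nc F) → Fin (nv F) → Bool
litTrue F τ C x = (pos F C x ∧ τ x) ∨ (neg F C x ∧ not (τ x))

-- clause C is satisfied by τ in the formula where only variables in X are kept
satOn : (F : CNF) → (Fin (nv F) → Bool) → (Fin (nv F) → Bool) → Fin (nc F) → Bool
satOn F X τ C = any (λ x → X x ∧ litTrue F τ C x) (allFin (nv F))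

-- F_{X,Cs}: keep the clauses in Cs and the variables in X.
-- S ⊆ Cs is precisely satisfiable in F_{X,Cs}
preciselySat : (F : CNF) → (X : Fin (nv F) → Bool) → (Cs : Fin (nc F) → Bool)
             → (S : Fin (nc F) → Bool) → Bool
preciselySat F X Cs S =
  all (λ C → S C ⇒B Cs C) (allFin (nc F)) ∧
  any (λ τ → all (λ C → Cs C ⇒B eqB (S C) (satOn F X τ C)) (allFin (nc F)))
      (allFuns (nv F))

psValue : (F : CNF) → (Fin (nv F) → Bool) → (Fin (nc F) → Bool) → ℕ
psValue F X Cs = count (preciselySat F X Cs) (allFuns (nc F))

-- Branch decompositions of a graph on Fin n.
-- Rooted trees with all degrees ≤ 3: non-root inner nodes have 1 or 2
-- children; the root may have 1, 2 or 3 children (or be a single leaf).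

data Sub (n : ℕ) : Set where
  leaf  : Fin n → Sub n
  node1 : Sub n → Sub n
  node2 : Sub n → Sub n → Sub n

data RTree (n : ℕ) : Set where
  root  : Sub n → RTree n
  root3 : Sub n → Sub n → Sub n → RTree n

leavesS : ∀ {n} → Sub n → List (Fin n)
leavesS (leaf v)    = v ∷ []
leavesS (node1 s)   = leavesS s
leavesS (node2 s t) = leavesS s ++ leavesS t

leavesR : ∀ {n} → RTree n → List (Fin n)
leavesR (root s)      = leavesS s
leavesR (root3 s t u) = leavesS s ++ leavesS t ++ leavesS u

-- for each node t, the list of vertices labelling the leaves below t
nodesS : ∀ {n} → Sub n → List (List (Fin n))
nodesS (leaf v)    = (v ∷ []) ∷ []
nodesS (node1 s)   = leavesS s ∷ nodesS s
nodesS (node2 s t) = (leavesS s ++ leavesS t) ∷ nodesS s ++ nodesS t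

nodesR : ∀ {n} → RTree n → List (List (Fin n))
nodesR (root s)      = nodesS s
nodesR (root3 s t u) = leavesR (root3 s t u) ∷ nodesS s ++ nodesS t ++ nodesS u

record BranchDec (n : ℕ) : Set where
  field
    tree : RTree n
    bij  : ∀ v → count (λ w → does (w Fin.≟ v)) (leavesR tree) ≡ 1
open BranchDec public

memB : ∀ {n} → List (Fin n) → Fin n → Bool
memB A v = any (λ w → does (w Fin.≟ v)) A

IsIndMatching : (G : Graph) → (A : Fin (n G) → Bool) → List (Fin (n G) × Fin (n G)) → Set
IsIndMatching G A M =
  All (λ e → T (A (proj₁ e)) × T (not (A (proj₂ e))) × T (adj G (proj₁ e) (proj₂ e))) M ×
  (∀ i j → i ≢ j →
     (proj₁ (lookup M i) ≢ proj₁ (lookup M j)) ×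
     (proj₂ (lookup M i) ≢ proj₂ (lookup M j)) ×
     ¬ T (adj G (proj₁ (lookup M i)) (proj₂ (lookup M j))))

MimWidthLE : (G : Graph) → BranchDec (n G) → ℕ → Set
MimWidthLE G D k = ∀ A → A ∈ nodesR (tree D) →
  ∀ M → IsIndMatching G (memB A) M → length M ≤ k

MimWidthGE : (G : Graph) → BranchDec (n G) → ℕ → Set
MimWidthGE G D k = Σ (List (Fin (n G))) λ A → A ∈ nodesR (tree D) ×
  Σ (List (Fin (n G) × Fin (n G))) λ M → IsIndMatching G (memB A) M × k ≤ length M

IsMimw : Graph → ℕ → Set
IsMimw G k = (Σ (BranchDec (n G)) λ D → MimWidthLE G D k) ×
             (∀ D → MimWidthGE G D k)

psCut : (F : CNF) → (Fin (nv F + nc F) → Bool) → ℕ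
psCut F A = psValue F X Cbar ⊔ psValue F Xbar C
  where
  X    = λ x → A (x ↑ˡ nc F)
  Xbar = λ x → not (A (x ↑ˡ nc F))
  C    = λ c → A (nv F ↑ʳ c)
  Cbar = λ c → not (A (nv F ↑ʳ c))

psWidthDec : (F : CNF) → BranchDec (nv F + nc F) → ℕ
psWidthDec F D = foldr _⊔_ 0 (map (λ A → psCut F (memB A)) (nodesR (tree D)))

IsPsw : CNF → ℕ → Set
IsPsw F p = (Σ (BranchDec (nv F + nc F)) λ D → psWidthDec F D ≡ p) ×
            (∀ D → p ≤ psWidthDec F D)

module Submission where

-- Let F have the colour classes of G as variables and clauses, each clause
-- containing its neighbours; then I(F) ≅ G.  A branch decomposition of I(F)
-- transfers to G, so some cut (A, Ā) carries an induced matching of size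
-- m ≥ mimw(G): variable–clause pairs (xᵢ, Cᵢ) across the cut with distinct
-- clauses, no xⱼ opposite Cᵢ occurring in Cᵢ for j ≠ i.  Making true exactly
-- the xᵢ of a chosen set of Cᵢ ∈ Ā satisfies precisely that set in F_{X,C̄},
-- so by the shattering lemma ps(F_{X,C̄}) ≥ 2^#{Cᵢ ∈ Ā}; symmetrically for A.

open import Defs
open import Data.Nat using (ℕ; zero; suc; _+_; _≤_; _^_; _*_; _⊔_; z≤n; s≤s)
open import Data.Nat.Properties
  using (≤-trans; ≤-reflexive; n≤1+n; +-suc; +-identityʳ; +-mono-≤; *-mono-≤;
         ^-monoʳ-≤; ^-distribˡ-+-*; m≤m⊔n; m≤n⊔m; module ≤-Reasoning)
open import Data.Bool using (Bool; true; false; _∧_; _∨_; not; if_then_else_; T)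
open import Data.Bool.Properties using (T-∧; T-∨; T-≡; ∨-identityʳ; not-involutive)
open import Data.Bool.ListAction using (any; all)
open import Data.Fin using (Fin; splitAt; _↑ˡ_; _↑ʳ_)
import Data.Fin as Fin
open import Data.Fin.Properties using (any?; splitAt⁻¹-↑ˡ; splitAt⁻¹-↑ʳ; splitAt-↑ˡ; splitAt-↑ʳ; +↔⊎; suc-injective)
open import Data.List using (List; []; _∷_; _++_; map; length; allFin; concatMap; foldr; lookup)
open import Data.List.Properties using (map-cong; map-++; map-∘)
open import Data.List.Membership.Propositional using (_∈_; lose)
open import Data.List.Membership.Propositional.Properties using (∈-allFin; ∈-lookup; ∈-map⁻; ∈-map⁺)
open import Data.List.Relation.Unary.Any using (here; there; satisfied)
import Data.List.Relation.Unary.All as All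
open import Data.List.Relation.Unary.All.Properties using (all⁻)
open import Data.List.Relation.Unary.Any.Properties using (any⁺; any⁻)
open import Data.Product using (Σ; ∃; _×_; _,_; proj₁; proj₂)
open import Data.Sum using (_⊎_; inj₁; inj₂)
open import Data.Empty using (⊥-elim)
open import Data.Unit using (tt)
open import Function using (_∘_)
open import Function.Bundles using (Inverse; Equivalence; mk↔ₛ′; mk⇔)
open import Function.Construct.Composition using (_↔-∘_)
open import Relation.Nullary using (¬_; does; Dec; yes; no)
open import Relation.Nullary.Decidable using (T?; _×-dec_; does-⇔)
open import Relation.Binary.PropositionalEquality

T-∧-intro : ∀ {a b} → T a → T b → T (a ∧ b)
T-∧-intro p q = Equivalence.from T-∧ (p , q)

T-∧-elim : ∀ {a b} → T (a ∧ b) → T a × T b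
T-∧-elim = Equivalence.to T-∧

T-∨-elim : ∀ {a b} → T (a ∨ b) → T a ⊎ T b
T-∨-elim = Equivalence.to T-∨

T-∨-introˡ : ∀ {a b} → T a → T (a ∨ b)
T-∨-introˡ p = Equivalence.from T-∨ (inj₁ p)

T-∨-introʳ : ∀ {a b} → T b → T (a ∨ b)
T-∨-introʳ q = Equivalence.from T-∨ (inj₂ q)

T⇒≡true : ∀ {a} → T a → a ≡ true
T⇒≡true = Equivalence.to T-≡

≡true⇒T : ∀ {a} → a ≡ true → T a
≡true⇒T = Equivalence.from T-≡

¬T⇒≡false : ∀ {a} → ¬ T a → a ≡ false
¬T⇒≡false {true}  ¬t = ⊥-elim (¬t tt)
¬T⇒≡false {false} _  = refl

from-does : ∀ {P : Set} (d : Dec P) → T (does d) → P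
from-does (yes p) _ = p

to-does : ∀ {P : Set} (d : Dec P) → P → T (does d)
to-does (yes _) _ = tt
to-does (no ¬p) p = ¬p p

any-intro : ∀ {A : Set} (p : A → Bool) {x xs} → x ∈ xs → T (p x) → T (any p xs)
any-intro p x∈xs px = any⁺ p (lose x∈xs px)

any-elim : ∀ {A : Set} (p : A → Bool) xs → T (any p xs) → ∃ λ x → T (p x)
any-elim p xs t = satisfied (any⁻ p xs t)

all-intro : ∀ {A : Set} (p : A → Bool) xs → (∀ x → T (p x)) → T (all p xs)
all-intro p xs h = all⁻ p {xs} (All.tabulate (λ {x} _ → h x))

any-cong : ∀ {A : Set} {p q : A → Bool} xs → (∀ x → p x ≡ q x) → any p xs ≡ any q xs
any-cong xs h = cong (foldr _∨_ false) (map-cong h xs)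

all-cong : ∀ {A : Set} {p q : A → Bool} xs → (∀ x → p x ≡ q x) → all p xs ≡ all q xs
all-cong xs h = cong (foldr _∧_ true) (map-cong h xs)

count-cong : ∀ {A : Set} {p q : A → Bool} xs → (∀ x → p x ≡ q x) → count p xs ≡ count q xs
count-cong []       h = refl
count-cong (x ∷ xs) h rewrite h x = cong (λ c → if _ then suc c else c) (count-cong xs h)

size : ∀ {N} → (Fin N → Bool) → ℕ
size {zero}  I = 0
size {suc N} I = if I Fin.zero then suc (size (I ∘ Fin.suc)) else size (I ∘ Fin.suc)

size-cong : ∀ {N} {I J : Fin N → Bool} → (∀ i → I i ≡ J i) → size I ≡ size J
size-cong {zero}  h = refl
size-cong {suc N} {I} {J} h rewrite h Fin.zero =
  cong (λ s → if J Fin.zero then suc s else s) (size-cong (h ∘ Fin.suc))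

size-split : ∀ {N} (I J : Fin N → Bool) →
  size I ≡ size (λ i → I i ∧ J i) + size (λ i → I i ∧ not (J i))
size-split {zero}  I J = refl
size-split {suc N} I J with I Fin.zero | J Fin.zero
... | false | _     = size-split (I ∘ Fin.suc) (J ∘ Fin.suc)
... | true  | true  = cong suc (size-split (I ∘ Fin.suc) (J ∘ Fin.suc))
... | true  | false = trans (cong suc (size-split (I ∘ Fin.suc) (J ∘ Fin.suc))) (sym (+-suc _ _))

size-insert : ∀ {N} (v : Fin N) (I : Fin N → Bool) → I v ≡ false →
  size (λ C → does (v Fin.≟ C) ∨ I C) ≡ suc (size I)
size-insert {suc N} Fin.zero I Iv≡false rewrite Iv≡false =
  refl
size-insert {suc N} (Fin.suc v) I Iv≡false
  with size-insert v (I ∘ Fin.suc) Iv≡false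
... | ih with I Fin.zero
...   | true  = cong suc ih
...   | false = ih

image : ∀ {m N} → (Fin m → Fin N) → Fin N → Bool
image cs C = does (any? (λ i → cs i Fin.≟ C))

size-image : ∀ {m N} (cs : Fin m → Fin N) → (∀ i j → i ≢ j → cs i ≢ cs j) →
  m ≤ size (image cs)
size-image {zero}  cs injective = z≤n
size-image {suc m} cs injective =
  subst (suc m ≤_) (sym (size-insert (cs Fin.zero) (image (cs ∘ Fin.suc)) fresh))
    (s≤s (size-image (cs ∘ Fin.suc) (λ i j i≢j → injective _ _ (i≢j ∘ suc-injective))))
  where
  fresh : image (cs ∘ Fin.suc) (cs Fin.zero) ≡ false
  fresh = ¬T⇒≡false λ t →
    let (i , csi≡cs0) = from-does (any? _) t in injective (Fin.suc i) Fin.zero (λ ()) csi≡cs0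

Extensional : ∀ {N} → ((Fin N → Bool) → Bool) → Set
Extensional {N} Q = ∀ {S S′ : Fin N → Bool} → (∀ i → S i ≡ S′ i) → Q S ≡ Q S′

Shatters : ∀ {N} → ((Fin N → Bool) → Bool) → (Fin N → Bool) → Set
Shatters {N} Q I = ∀ (b : Fin N → Bool) →
  ∃ λ S → T (Q S) × (∀ i → T (I i) → S i ≡ b i)

count-pairs : ∀ {A B : Set} (Q : B → Bool) (g h : A → B) xs →
  count Q (concatMap (λ f → g f ∷ h f ∷ []) xs) ≡ count (Q ∘ g) xs + count (Q ∘ h) xs
count-pairs Q g h [] = refl
count-pairs Q g h (x ∷ xs) with count-pairs Q g h xs
... | ih with Q (g x) | Q (h x)
...   | true  | true  = cong suc (trans (cong suc ih) (sym (+-suc _ _)))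
...   | true  | false = cong suc ih
...   | false | true  = trans (cong suc ih) (sym (+-suc _ _))
...   | false | false = ih

count-∨ : ∀ {A : Set} (p q : A → Bool) xs → count (λ x → p x ∨ q x) xs ≤ count p xs + count q xs
count-∨ p q [] = z≤n
count-∨ p q (x ∷ xs) with count-∨ p q xs
... | ih with p x | q x
...   | true  | true  = s≤s (≤-trans ih (≤-trans (n≤1+n _) (≤-reflexive (sym (+-suc _ _)))))
...   | true  | false = s≤s ih
...   | false | true  = subst (suc (count (λ x → p x ∨ q x) xs) ≤_) (sym (+-suc _ _)) (s≤s ih)
...   | false | false = ih

count-allFuns : ∀ {N} (Q : (Fin (suc N) → Bool) → Bool) →
  count Q (allFuns (suc N)) ≡ count (Q ∘ consB false) (allFuns N) + count (Q ∘ consB true) (allFuns N)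
count-allFuns {N} Q = count-pairs Q (consB false) (consB true) (allFuns N)

consB-η : ∀ {N} (S : Fin (suc N) → Bool) → ∀ i → consB (S Fin.zero) (S ∘ Fin.suc) i ≡ S i
consB-η S Fin.zero    = refl
consB-η S (Fin.suc i) = refl

extensional-consB : ∀ {N} {Q : (Fin (suc N) → Bool) → Bool} → Extensional Q →
  ∀ β → Extensional (Q ∘ consB β)
extensional-consB ext β h = ext λ { Fin.zero → refl ; (Fin.suc i) → h i }

shatters-fix : ∀ {N} {Q : (Fin (suc N) → Bool) → Bool} {I} → Extensional Q → Shatters Q I →
  T (I Fin.zero) → ∀ β → Shatters (Q ∘ consB β) (I ∘ Fin.suc)
shatters-fix {Q = Q} ext sh zero∈I β b with sh (consB β b)
... | S , QS , agrees = S ∘ Fin.suc , subst T (ext (λ i → sym (consB-η′ i))) QS , agrees ∘ Fin.suc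
  where
  consB-η′ : ∀ i → consB β (S ∘ Fin.suc) i ≡ S i
  consB-η′ Fin.zero    = sym (agrees Fin.zero zero∈I)
  consB-η′ (Fin.suc i) = refl

shatters-merge : ∀ {N} {Q : (Fin (suc N) → Bool) → Bool} {I} → Extensional Q → Shatters Q I →
  Shatters (λ f → Q (consB false f) ∨ Q (consB true f)) (I ∘ Fin.suc)
shatters-merge {Q = Q} ext sh b with sh (consB false b)
... | S , QS , agrees = S ∘ Fin.suc , in-half (S Fin.zero) (subst T (ext (λ i → sym (consB-η S i))) QS) ,
                        agrees ∘ Fin.suc
  where
  in-half : ∀ β {f} → T (Q (consB β f)) → T (Q (consB false f) ∨ Q (consB true f))
  in-half false = T-∨-introˡ
  in-half true  = T-∨-introʳ

-- By induction on N: if zero ∈ I, both halves (zero ∉ S, zero ∈ S) shatter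
-- the tail of I; otherwise their union does.
shatter-bound : ∀ {N} (Q : (Fin N → Bool) → Bool) (I : Fin N → Bool) →
  Extensional Q → Shatters Q I → 2 ^ size I ≤ count Q (allFuns N)
shatter-bound {zero} Q I ext sh with sh (λ ())
... | S , QS , _ = one-member (subst T (ext (λ ())) QS)
  where
  one-member : ∀ {b} → T b → 1 ≤ (if b then 1 else 0)
  one-member {true} _ = s≤s z≤n
shatter-bound {suc N} Q I ext sh with I Fin.zero in zero∈I
... | true = begin
    2 ^ size I′ + (2 ^ size I′ + 0)
  ≡⟨ cong (2 ^ size I′ +_) (+-identityʳ _) ⟩
    2 ^ size I′ + 2 ^ size I′
  ≤⟨ +-mono-≤ (half false) (half true) ⟩
    count Q₀ (allFuns N) + count Q₁ (allFuns N)
  ≡⟨ count-allFuns Q ⟨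
    count Q (allFuns (suc N))
  ∎
  where
  open ≤-Reasoning
  I′ = I ∘ Fin.suc
  Q₀ = Q ∘ consB false
  Q₁ = Q ∘ consB true
  half : ∀ β → 2 ^ size I′ ≤ count (Q ∘ consB β) (allFuns N)
  half β = shatter-bound (Q ∘ consB β) I′ (extensional-consB ext β)
                         (shatters-fix ext sh (≡true⇒T zero∈I) β)
... | false = begin
    2 ^ size I′
  ≤⟨ shatter-bound (λ f → Q₀ f ∨ Q₁ f) I′
       (λ h → cong₂ _∨_ (extensional-consB ext false h) (extensional-consB ext true h))
       (shatters-merge ext sh) ⟩
    count (λ f → Q₀ f ∨ Q₁ f) (allFuns N)
  ≤⟨ count-∨ Q₀ Q₁ (allFuns N) ⟩
    count Q₀ (allFuns N) + count Q₁ (allFuns N)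
  ≡⟨ count-allFuns Q ⟨
    count Q (allFuns (suc N))
  ∎
  where
  open ≤-Reasoning
  I′ = I ∘ Fin.suc
  Q₀ = Q ∘ consB false
  Q₁ = Q ∘ consB true

satOn-cong : (F : CNF) (X : Fin (nv F) → Bool) {τ τ′ : Fin (nv F) → Bool} →
  (∀ x → τ x ≡ τ′ x) → ∀ C → satOn F X τ C ≡ satOn F X τ′ C
satOn-cong F X τ≗τ′ C = any-cong (allFin (nv F))
  (λ x → cong (λ v → X x ∧ ((pos F C x ∧ v) ∨ (neg F C x ∧ not v))) (τ≗τ′ x))

allFuns-complete : ∀ N (f : Fin N → Bool) → ∃ λ g → g ∈ allFuns N × (∀ i → g i ≡ f i)
allFuns-complete zero    f = (λ ()) , here refl , λ ()
allFuns-complete (suc N) f with allFuns-complete N (f ∘ Fin.suc)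
... | g , g∈ , g≗f = consB (f Fin.zero) g , consB-∈ (f Fin.zero) (allFuns N) g∈ ,
                     λ { Fin.zero → refl ; (Fin.suc i) → g≗f i }
  where
  consB-∈ : ∀ β {g : Fin N → Bool} xs → g ∈ xs →
    consB β g ∈ concatMap (λ f → consB false f ∷ consB true f ∷ []) xs
  consB-∈ false (_ ∷ _)  (here refl) = here refl
  consB-∈ true  (_ ∷ _)  (here refl) = there (here refl)
  consB-∈ β     (_ ∷ xs) (there g∈)  = there (there (consB-∈ β xs g∈))

satisfied-preciselySat : (F : CNF) (X : Fin (nv F) → Bool) (Cs : Fin (nc F) → Bool) →
  ∀ τ → T (preciselySat F X Cs (λ C → Cs C ∧ satOn F X τ C))
satisfied-preciselySat F X Cs τ with allFuns-complete (nv F) τ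
... | g , g∈ , g≗τ = T-∧-intro
  (all-intro _ (allFin (nc F)) (λ C → subset (Cs C) (satOn F X τ C)))
  (any-intro _ g∈ (all-intro _ (allFin (nc F)) λ C →
    subst (λ s → T (Cs C ⇒B eqB (Cs C ∧ satOn F X τ C) s)) (sym (satOn-cong F X g≗τ C))
          (exact (Cs C) (satOn F X τ C))))
  where
  subset : ∀ a s → T ((a ∧ s) ⇒B a)
  subset true  true  = tt
  subset true  false = tt
  subset false _     = tt
  exact : ∀ a s → T (a ⇒B eqB (a ∧ s) s)
  exact false _     = tt
  exact true  true  = tt
  exact true  false = tt

satOn-intro : (F : CNF) (X τ : Fin (nv F) → Bool) {C : Fin (nc F)} (x : Fin (nv F)) →
  T (X x) → T (pos F C x) → T (τ x) → T (satOn F X τ C)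
satOn-intro F X τ x Xx Cx τx =
  any-intro _ (∈-allFin x) (T-∧-intro Xx (T-∨-introˡ (T-∧-intro Cx τx)))

satOn-elim : (F : CNF) → Monotone F → (X τ : Fin (nv F) → Bool) (C : Fin (nc F)) →
  T (satOn F X τ C) → ∃ λ x → T (X x) × T (pos F C x) × T (τ x)
satOn-elim F mono X τ C sat with any-elim _ (allFin (nv F)) sat
... | x , kept∧lit with T-∧-elim kept∧lit
...   | Xx , lit with T-∨-elim {pos F C x ∧ τ x} lit
...     | inj₁ Cx∧τx = x , Xx , T-∧-elim Cx∧τx
...     | inj₂ negCx = ⊥-elim (subst T (cong (_∧ not (τ x)) (mono C x)) negCx)

-- Let (xsᵢ, csᵢ) be variable–clause pairs of a monotone F
-- with xsᵢ ∈ csᵢ, such that every clause csᵢ ∈ Cs has xsᵢ ∈ X, and no kept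
-- variable xsⱼ occurs in another kept clause csᵢ.  Then every subset of the
-- kept matched clauses is precisely satisfiable in F_{X,Cs}: set true exactly
-- the variables matched to the chosen clauses.
module PSLemma (F : CNF) (mono : Monotone F) (X : Fin (nv F) → Bool) (Cs : Fin (nc F) → Bool)
  {m : ℕ} (xs : Fin m → Fin (nv F)) (cs : Fin m → Fin (nc F))
  (matched : ∀ i → T (pos F (cs i) (xs i)))
  (kept : ∀ i → T (Cs (cs i)) → T (X (xs i)))
  (induced : ∀ i j → T (Cs (cs i)) → T (X (xs j)) → T (pos F (cs i) (xs j)) → cs i ≡ cs j)
  where

  assignment : (Fin (nc F) → Bool) → Fin (nv F) → Bool
  assignment b x = does (any? (λ j → xs j Fin.≟ x ×-dec T? (b (cs j))))

  -- Under this assignment a kept matched clause is satisfied iff it was chosen;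
  -- a wrongly satisfied clause would contain the variable of another one.
  satisfies-chosen : ∀ b i → T (Cs (cs i)) → satOn F X (assignment b) (cs i) ≡ b (cs i)
  satisfies-chosen b i kept-i with b (cs i) in chosen
  ... | true  = T⇒≡true (satOn-intro F X (assignment b) (xs i) (kept i kept-i) (matched i)
                  (to-does (any? _) (i , refl , ≡true⇒T chosen)))
  ... | false = ¬T⇒≡false λ sat →
    let (x , Xx , Cx , τx) = satOn-elim F mono X (assignment b) (cs i) sat
        (j , xsj≡x , chosen-j) = from-does (any? (λ j → xs j Fin.≟ x ×-dec T? (b (cs j)))) τx
        same = induced i j kept-i (subst (T ∘ X) (sym xsj≡x) Xx)
                                  (subst (T ∘ pos F (cs i)) (sym xsj≡x) Cx)
    in subst T (trans (cong b (sym same)) chosen) chosen-j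

  shatters : Shatters (preciselySat F X Cs) (λ C → image cs C ∧ Cs C)
  shatters b = (λ C → Cs C ∧ satOn F X (assignment b) C) ,
               satisfied-preciselySat F X Cs (assignment b) ,
               agrees
    where
    agrees : ∀ C → T (image cs C ∧ Cs C) → Cs C ∧ satOn F X (assignment b) C ≡ b C
    agrees C matched∧kept with T-∧-elim matched∧kept
    ... | inImage , kept-C with from-does (any? (λ i → cs i Fin.≟ C)) inImage
    ...   | i , refl rewrite T⇒≡true kept-C = satisfies-chosen b i kept-C

  extensional : Extensional (preciselySat F X Cs)
  extensional S≗S′ = cong₂ _∧_
    (all-cong (allFin (nc F)) (λ C → cong (_⇒B Cs C) (S≗S′ C)))
    (any-cong (allFuns (nv F)) λ τ → all-cong (allFin (nc F))
       (λ C → cong (λ s → Cs C ⇒B eqB s (satOn F X τ C)) (S≗S′ C)))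

  ps-bound : 2 ^ size (λ C → image cs C ∧ Cs C) ≤ psValue F X Cs
  ps-bound = shatter-bound (preciselySat F X Cs) _ extensional shatters

record IndMatching (G : Graph) (A : Fin (n G) → Bool) (m : ℕ) : Set where
  field
    left right : Fin m → Fin (n G)
    crossing   : ∀ i → T (A (left i)) × T (not (A (right i))) × T (adj G (left i) (right i))
    separated  : ∀ i j → i ≢ j →
      (left i ≢ left j) × (right i ≢ right j) × ¬ T (adj G (left i) (right j))

indMatching-fromList : (G : Graph) (A : Fin (n G) → Bool) (M : List (Fin (n G) × Fin (n G))) →
  IsIndMatching G A M → IndMatching G A (length M)
indMatching-fromList G A M (edges , separated) = record
  { left      = proj₁ ∘ lookup M
  ; right     = proj₂ ∘ lookup M
  ; crossing  = λ i → All.lookup edges (∈-lookup i)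
  ; separated = separated
  }

varSide : (F : CNF) → (Fin (nv F + nc F) → Bool) → Fin (nv F) → Bool
varSide F A x = A (x ↑ˡ nc F)

claSide : (F : CNF) → (Fin (nv F + nc F) → Bool) → Fin (nc F) → Bool
claSide F A C = A (nv F ↑ʳ C)

adj-var-cla : (F : CNF) → Monotone F → ∀ x C → adj (incidence F) (x ↑ˡ nc F) (nv F ↑ʳ C) ≡ pos F C x
adj-var-cla F mono x C
  rewrite splitAt-↑ˡ (nv F) x (nc F) | splitAt-↑ʳ (nv F) (nc F) C | mono C x = ∨-identityʳ _

adj-cla-var : (F : CNF) → Monotone F → ∀ x C → adj (incidence F) (nv F ↑ʳ C) (x ↑ˡ nc F) ≡ pos F C x
adj-cla-var F mono x C
  rewrite splitAt-↑ˡ (nv F) x (nc F) | splitAt-↑ʳ (nv F) (nc F) C | mono C x = ∨-identityʳ _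

data Edge (F : CNF) : Fin (nv F + nc F) → Fin (nv F + nc F) → Set where
  var-cla : ∀ x C → Edge F (x ↑ˡ nc F) (nv F ↑ʳ C)
  cla-var : ∀ x C → Edge F (nv F ↑ʳ C) (x ↑ˡ nc F)

-- Classify an edge of I(F) by where splitAt places its ends; the remaining
-- cases (two variables or two clauses) have no edge and are absurd.
edge : (F : CNF) → ∀ u v → T (adj (incidence F) u v) → Edge F u v
edge F u v uv with splitAt (nv F) u in su | splitAt (nv F) v in sv
... | inj₁ x | inj₂ C = subst₂ (Edge F) (splitAt⁻¹-↑ˡ su) (splitAt⁻¹-↑ʳ sv) (var-cla x C)
... | inj₂ C | inj₁ x = subst₂ (Edge F) (splitAt⁻¹-↑ʳ su) (splitAt⁻¹-↑ˡ sv) (cla-var x C)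

edgeVar : ∀ {F u v} → Edge F u v → Fin (nv F)
edgeVar (var-cla x C) = x
edgeVar (cla-var x C) = x

edgeCla : ∀ {F u v} → Edge F u v → Fin (nc F)
edgeCla (var-cla x C) = C
edgeCla (cla-var x C) = C

record ClauseMatching (F : CNF) (A : Fin (nv F + nc F) → Bool) (m : ℕ) : Set where
  field
    var      : Fin m → Fin (nv F)
    cla      : Fin m → Fin (nc F)
    contains : ∀ i → T (pos F (cla i) (var i))
    opposite : ∀ i → varSide F A (var i) ≡ not (claSide F A (cla i))
    distinct : ∀ i j → i ≢ j → cla i ≢ cla j
    induced  : ∀ i j → varSide F A (var j) ≡ not (claSide F A (cla i)) →
               T (pos F (cla i) (var j)) → cla i ≡ cla j

module _ (F : CNF) (A : Fin (nv F + nc F) → Bool) where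

  private
    sides : ∀ {a c} → T a → T (not c) → a ≡ not c
    sides {true} {false} _ _ = refl

    sides′ : ∀ {a c} → T (not a) → T c → a ≡ not c
    sides′ {false} {true} _ _ = refl

    ¬T-both : ∀ {a} → T a → ¬ T (not a)
    ¬T-both {true} _ ()

  edge-opposite : ∀ {u v} (e : Edge F u v) → T (A u) → T (not (A v)) →
    varSide F A (edgeVar e) ≡ not (claSide F A (edgeCla e))
  edge-opposite (var-cla x C) u∈A v∉A = sides u∈A v∉A
  edge-opposite (cla-var x C) u∈A v∉A = sides′ v∉A u∈A

  edges-distinct : ∀ {u v u′ v′} (e : Edge F u v) (e′ : Edge F u′ v′) →
    T (A u) → T (not (A v)) → T (A u′) → T (not (A v′)) →
    u ≢ u′ → v ≢ v′ → edgeCla e ≢ edgeCla e′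
  edges-distinct (var-cla _ _) (var-cla _ _) _ _ _ _ _ v≢v′ refl = v≢v′ refl
  edges-distinct (cla-var _ _) (cla-var _ _) _ _ _ _ u≢u′ _ refl = u≢u′ refl
  edges-distinct (var-cla _ _) (cla-var _ _) _ v∉A u′∈A _ _ _ refl = ¬T-both u′∈A v∉A
  edges-distinct (cla-var _ _) (var-cla _ _) u∈A _ _ v′∉A _ _ refl = ¬T-both u∈A v′∉A

  edges-induced : Monotone F → ∀ {u v u′ v′} (e : Edge F u v) (e′ : Edge F u′ v′) →
    T (A u) → T (not (A v)) → T (A u′) → T (not (A v′)) →
    ¬ T (adj (incidence F) u′ v) → ¬ T (adj (incidence F) u v′) →
    varSide F A (edgeVar e′) ≡ not (claSide F A (edgeCla e)) →
    ¬ T (pos F (edgeCla e) (edgeVar e′))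
  edges-induced mono (var-cla x C) (var-cla x′ C′) _ _ _ _ ¬u′v _ _ Cx′ =
    ¬u′v (subst T (sym (adj-var-cla F mono x′ C)) Cx′)
  edges-induced mono (cla-var x C) (cla-var x′ C′) _ _ _ _ _ ¬uv′ _ Cx′ =
    ¬uv′ (subst T (sym (adj-cla-var F mono x′ C)) Cx′)
  edges-induced mono (var-cla x C) (cla-var x′ C′) _ C∉A _ x′∉A _ _ opp _ =
    ¬T-both (subst T (sym opp) C∉A) x′∉A
  edges-induced mono (cla-var x C) (var-cla x′ C′) C∈A _ x′∈A _ _ _ opp _ =
    ¬T-both x′∈A (subst (T ∘ not) (sym opp) (subst T (sym (not-involutive _)) C∈A))

  clauseMatching : Monotone F → ∀ {m} → IndMatching (incidence F) A m → ClauseMatching F A m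
  clauseMatching mono M = record
    { var      = edgeVar ∘ edgeOf
    ; cla      = edgeCla ∘ edgeOf
    ; contains = λ i → subst T (adjacency (edgeOf i)) (proj₂ (proj₂ (crossing i)))
    ; opposite = λ i → edge-opposite (edgeOf i) (proj₁ (crossing i)) (proj₁ (proj₂ (crossing i)))
    ; distinct = λ i j i≢j → edges-distinct (edgeOf i) (edgeOf j) (inA i) (outA i) (inA j) (outA j)
                   (proj₁ (separated i j i≢j)) (proj₁ (proj₂ (separated i j i≢j)))
    ; induced  = induced
    }
    where
    open IndMatching M
    inA : ∀ i → T (A (left i))
    inA i = proj₁ (crossing i)
    outA : ∀ i → T (not (A (right i)))
    outA i = proj₁ (proj₂ (crossing i))
    edgeOf : ∀ i → Edge F (left i) (right i)
    edgeOf i = edge F (left i) (right i) (proj₂ (proj₂ (crossing i)))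
    adjacency : ∀ {u v} (e : Edge F u v) → adj (incidence F) u v ≡ pos F (edgeCla e) (edgeVar e)
    adjacency (var-cla x C) = adj-var-cla F mono x C
    adjacency (cla-var x C) = adj-cla-var F mono x C
    induced : ∀ i j → varSide F A (edgeVar (edgeOf j)) ≡ not (claSide F A (edgeCla (edgeOf i))) →
      T (pos F (edgeCla (edgeOf i)) (edgeVar (edgeOf j))) → edgeCla (edgeOf i) ≡ edgeCla (edgeOf j)
    induced i j opp occurs with i Fin.≟ j
    ... | yes refl = refl
    ... | no i≢j   = ⊥-elim (edges-induced mono (edgeOf i) (edgeOf j) (inA i) (outA i) (inA j) (outA j)
                       (proj₂ (proj₂ (separated j i (i≢j ∘ sym)))) (proj₂ (proj₂ (separated i j i≢j)))
                       opp occurs)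

-- The PS bound of a cut.  The matched clauses outside A are shattered in
-- F_{X, C̄} and those inside A in F_{X̄, C}; their numbers add up to m.
clauseMatching-ps : (F : CNF) → Monotone F → (A : Fin (nv F + nc F) → Bool) → ∀ {m} →
  ClauseMatching F A m → 2 ^ m ≤ psCut F A * psCut F A
clauseMatching-ps F mono A {m} M = begin
    2 ^ m
  ≤⟨ ^-monoʳ-≤ 2 (size-image cla distinct) ⟩
    2 ^ size (image cla)
  ≡⟨ cong (2 ^_) (size-split (image cla) AC) ⟩
    2 ^ (inside + outside)
  ≡⟨ ^-distribˡ-+-* 2 inside outside ⟩
    2 ^ inside * 2 ^ outside
  ≤⟨ *-mono-≤ inside-bound outside-bound ⟩
    psIn * psOut
  ≤⟨ *-mono-≤ (m≤n⊔m psOut psIn) (m≤m⊔n psOut psIn) ⟩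
    psCut F A * psCut F A
  ∎
  where
  open ≤-Reasoning
  open ClauseMatching M
  AV = varSide F A
  AC = claSide F A
  psIn    = psValue F (not ∘ AV) AC
  psOut   = psValue F AV (not ∘ AC)
  inside  = size (λ C → image cla C ∧ AC C)
  outside = size (λ C → image cla C ∧ not (AC C))

  outside-bound : 2 ^ outside ≤ psOut
  outside-bound = PSLemma.ps-bound F mono AV (not ∘ AC) var cla contains
    (λ i C∉A → subst T (sym (opposite i)) C∉A)
    (λ i j C∉A x∈A → induced i j (trans (T⇒≡true x∈A) (sym (T⇒≡true C∉A))))

  inside-bound : 2 ^ inside ≤ psIn
  inside-bound = PSLemma.ps-bound F mono (not ∘ AV) AC var cla contains
    (λ i C∈A → subst T (sym (trans (cong not (opposite i)) (not-involutive _))) C∈A)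
    (λ i j C∈A x∉A → induced i j
      (trans (sym (not-involutive _)) (cong not (trans (T⇒≡true x∉A) (sym (T⇒≡true C∈A))))))

count-map : ∀ {A B : Set} (p : B → Bool) (f : A → B) xs → count p (map f xs) ≡ count (p ∘ f) xs
count-map p f []       = refl
count-map p f (x ∷ xs) = cong (λ c → if p (f x) then suc c else c) (count-map p f xs)

≤-foldr-⊔ : ∀ {x} xs → x ∈ xs → x ≤ foldr _⊔_ 0 xs
≤-foldr-⊔ (y ∷ ys) (here refl) = m≤m⊔n y _
≤-foldr-⊔ (y ∷ ys) (there x∈) = ≤-trans (≤-foldr-⊔ ys x∈) (m≤n⊔m y _)

module Transfer (H G : Graph) (iso : H ≅ G) where

  open Inverse (proj₁ iso) using (to; from; strictlyInverseˡ; strictlyInverseʳ)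

  adj-to : ∀ u v → adj H u v ≡ adj G (to u) (to v)
  adj-to = proj₂ iso

  adj-from : ∀ u v → adj H (from u) (from v) ≡ adj G u v
  adj-from u v = trans (adj-to _ _) (cong₂ (adj G) (strictlyInverseˡ u) (strictlyInverseˡ v))

  from-injective : ∀ {u v} → from u ≡ from v → u ≡ v
  from-injective {u} {v} eq = trans (sym (strictlyInverseˡ u)) (trans (cong to eq) (strictlyInverseˡ v))

  mapS : Sub (n H) → Sub (n G)
  mapS (leaf v)    = leaf (to v)
  mapS (node1 s)   = node1 (mapS s)
  mapS (node2 s t) = node2 (mapS s) (mapS t)

  mapR : RTree (n H) → RTree (n G)
  mapR (root s)      = root (mapS s)
  mapR (root3 s t u) = root3 (mapS s) (mapS t) (mapS u)

  leavesS-map : ∀ s → leavesS (mapS s) ≡ map to (leavesS s)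
  leavesS-map (leaf v)    = refl
  leavesS-map (node1 s)   = leavesS-map s
  leavesS-map (node2 s t) =
    trans (cong₂ _++_ (leavesS-map s) (leavesS-map t)) (sym (map-++ to (leavesS s) (leavesS t)))

  leavesR-map : ∀ r → leavesR (mapR r) ≡ map to (leavesR r)
  leavesR-map (root s)      = leavesS-map s
  leavesR-map (root3 s t u) = begin
      leavesS (mapS s) ++ leavesS (mapS t) ++ leavesS (mapS u)
    ≡⟨ cong₂ _++_ (leavesS-map s) (cong₂ _++_ (leavesS-map t) (leavesS-map u)) ⟩
      map to (leavesS s) ++ map to (leavesS t) ++ map to (leavesS u)
    ≡⟨ cong (map to (leavesS s) ++_) (map-++ to (leavesS t) (leavesS u)) ⟨
      map to (leavesS s) ++ map to (leavesS t ++ leavesS u)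
    ≡⟨ map-++ to (leavesS s) (leavesS t ++ leavesS u) ⟨
      map to (leavesS s ++ leavesS t ++ leavesS u)
    ∎
    where open ≡-Reasoning

  nodesS-map : ∀ s → nodesS (mapS s) ≡ map (map to) (nodesS s)
  nodesS-map (leaf v)    = refl
  nodesS-map (node1 s)   = cong₂ _∷_ (leavesS-map s) (nodesS-map s)
  nodesS-map (node2 s t) = cong₂ _∷_
    (trans (cong₂ _++_ (leavesS-map s) (leavesS-map t)) (sym (map-++ to (leavesS s) (leavesS t))))
    (trans (cong₂ _++_ (nodesS-map s) (nodesS-map t)) (sym (map-++ (map to) (nodesS s) (nodesS t))))

  nodesR-map : ∀ r → nodesR (mapR r) ≡ map (map to) (nodesR r)
  nodesR-map (root s)      = nodesS-map s
  nodesR-map (root3 s t u) = cong₂ _∷_ (leavesR-map (root3 s t u)) (begin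
      nodesS (mapS s) ++ nodesS (mapS t) ++ nodesS (mapS u)
    ≡⟨ cong₂ _++_ (nodesS-map s) (cong₂ _++_ (nodesS-map t) (nodesS-map u)) ⟩
      map (map to) (nodesS s) ++ map (map to) (nodesS t) ++ map (map to) (nodesS u)
    ≡⟨ cong (map (map to) (nodesS s) ++_) (map-++ (map to) (nodesS t) (nodesS u)) ⟨
      map (map to) (nodesS s) ++ map (map to) (nodesS t ++ nodesS u)
    ≡⟨ map-++ (map to) (nodesS s) (nodesS t ++ nodesS u) ⟨
      map (map to) (nodesS s ++ nodesS t ++ nodesS u)
    ∎)
    where open ≡-Reasoning

  is-image : ∀ w v → does (to w Fin.≟ v) ≡ does (w Fin.≟ from v)
  is-image w v = does-⇔ (mk⇔ (λ eq → trans (sym (strictlyInverseʳ w)) (cong from eq))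
                              (λ eq → trans (cong to eq) (strictlyInverseˡ v)))
                        (to w Fin.≟ v) (w Fin.≟ from v)

  mapD : BranchDec (n H) → BranchDec (n G)
  mapD D = record
    { tree = mapR (tree D)
    ; bij  = λ v → begin
        count (λ w → does (w Fin.≟ v)) (leavesR (mapR (tree D)))
      ≡⟨ cong (count (λ w → does (w Fin.≟ v))) (leavesR-map (tree D)) ⟩
        count (λ w → does (w Fin.≟ v)) (map to (leavesR (tree D)))
      ≡⟨ count-map _ to (leavesR (tree D)) ⟩
        count (λ w → does (to w Fin.≟ v)) (leavesR (tree D))
      ≡⟨ count-cong (leavesR (tree D)) (λ w → is-image w v) ⟩
        count (λ w → does (w Fin.≟ from v)) (leavesR (tree D))
      ≡⟨ bij D (from v) ⟩
        1
      ∎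
    }
    where open ≡-Reasoning

  memB-map : ∀ A v → memB (map to A) v ≡ memB A (from v)
  memB-map A v =
    trans (cong (foldr _∨_ false) (sym (map-∘ A))) (any-cong A (λ w → is-image w v))

  pullback : ∀ A {m} → IndMatching G (memB (map to A)) m → IndMatching H (memB A) m
  pullback A M = record
    { left      = from ∘ left
    ; right     = from ∘ right
    ; crossing  = λ i → let (u∈A , v∉A , uv) = crossing i in
        subst T (memB-map A (left i)) u∈A ,
        subst (T ∘ not) (memB-map A (right i)) v∉A ,
        subst T (sym (adj-from (left i) (right i))) uv
    ; separated = λ i j i≢j → let (u≢u′ , v≢v′ , ¬uv′) = separated i j i≢j in
        u≢u′ ∘ from-injective , v≢v′ ∘ from-injective , ¬uv′ ∘ subst T (adj-from (left i) (right j))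
    }
    where open IndMatching M

  wideCut : ∀ D k → MimWidthGE G (mapD D) k →
    ∃ λ A → A ∈ nodesR (tree D) × ∃ λ m → k ≤ m × IndMatching H (memB A) m
  wideCut D k (A′ , A′∈ , M , isMatching , k≤|M|)
    with ∈-map⁻ (map to) (subst (A′ ∈_) (nodesR-map (tree D)) A′∈)
  ... | A , A∈ , refl =
    A , A∈ , length M , k≤|M| , pullback A (indMatching-fromList G (memB (map to A)) M isMatching)

record ColourClasses {n : ℕ} (c : Fin n → Bool) : Set where
  field
    a b        : ℕ
    enum       : Fin a ⊎ Fin b → Fin n
    index      : Fin n → Fin a ⊎ Fin b
    enum-index : ∀ v → enum (index v) ≡ v
    index-enum : ∀ p → index (enum p) ≡ p
    colour₀    : ∀ x → c (enum (inj₁ x)) ≡ false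
    colour₁    : ∀ y → c (enum (inj₂ y)) ≡ true

add₀ : ∀ {n} (c : Fin (suc n) → Bool) → c Fin.zero ≡ false →
  ColourClasses (c ∘ Fin.suc) → ColourClasses c
add₀ c c₀ K = record
  { a = suc a ; b = b ; enum = enum′ ; index = index′
  ; enum-index = λ { Fin.zero → refl ; (Fin.suc v) → trans (enum-shift (index v)) (cong Fin.suc (enum-index v)) }
  ; index-enum = λ { (inj₁ Fin.zero) → refl ; (inj₁ (Fin.suc x)) → cong shift (index-enum (inj₁ x))
                   ; (inj₂ y) → cong shift (index-enum (inj₂ y)) }
  ; colour₀ = λ { Fin.zero → c₀ ; (Fin.suc x) → colour₀ x }
  ; colour₁ = colour₁
  }
  where
  open ColourClasses K
  shift : Fin a ⊎ Fin b → Fin (suc a) ⊎ Fin b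
  shift (inj₁ x) = inj₁ (Fin.suc x)
  shift (inj₂ y) = inj₂ y
  enum′ : Fin (suc a) ⊎ Fin b → Fin (suc _)
  enum′ (inj₁ Fin.zero)    = Fin.zero
  enum′ (inj₁ (Fin.suc x)) = Fin.suc (enum (inj₁ x))
  enum′ (inj₂ y)           = Fin.suc (enum (inj₂ y))
  index′ : Fin (suc _) → Fin (suc a) ⊎ Fin b
  index′ Fin.zero    = inj₁ Fin.zero
  index′ (Fin.suc v) = shift (index v)
  enum-shift : ∀ p → enum′ (shift p) ≡ Fin.suc (enum p)
  enum-shift (inj₁ x) = refl
  enum-shift (inj₂ y) = refl

add₁ : ∀ {n} (c : Fin (suc n) → Bool) → c Fin.zero ≡ true →
  ColourClasses (c ∘ Fin.suc) → ColourClasses c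
add₁ c c₀ K = record
  { a = a ; b = suc b ; enum = enum′ ; index = index′
  ; enum-index = λ { Fin.zero → refl ; (Fin.suc v) → trans (enum-shift (index v)) (cong Fin.suc (enum-index v)) }
  ; index-enum = λ { (inj₂ Fin.zero) → refl ; (inj₂ (Fin.suc y)) → cong shift (index-enum (inj₂ y))
                   ; (inj₁ x) → cong shift (index-enum (inj₁ x)) }
  ; colour₀ = colour₀
  ; colour₁ = λ { Fin.zero → c₀ ; (Fin.suc y) → colour₁ y }
  }
  where
  open ColourClasses K
  shift : Fin a ⊎ Fin b → Fin a ⊎ Fin (suc b)
  shift (inj₁ x) = inj₁ x
  shift (inj₂ y) = inj₂ (Fin.suc y)
  enum′ : Fin a ⊎ Fin (suc b) → Fin (suc _)
  enum′ (inj₂ Fin.zero)    = Fin.zero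
  enum′ (inj₂ (Fin.suc y)) = Fin.suc (enum (inj₂ y))
  enum′ (inj₁ x)           = Fin.suc (enum (inj₁ x))
  index′ : Fin (suc _) → Fin a ⊎ Fin (suc b)
  index′ Fin.zero    = inj₂ Fin.zero
  index′ (Fin.suc v) = shift (index v)
  enum-shift : ∀ p → enum′ (shift p) ≡ Fin.suc (enum p)
  enum-shift (inj₁ x) = refl
  enum-shift (inj₂ y) = refl

colourClasses : ∀ {n} (c : Fin n → Bool) → ColourClasses c
colourClasses {zero} c = record
  { a = 0 ; b = 0 ; enum = λ { (inj₁ ()) ; (inj₂ ()) } ; index = λ ()
  ; enum-index = λ () ; index-enum = λ { (inj₁ ()) ; (inj₂ ()) } ; colour₀ = λ () ; colour₁ = λ () }
colourClasses {suc n} c with c Fin.zero in c₀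
... | false = add₀ c c₀ (colourClasses (c ∘ Fin.suc))
... | true  = add₁ c c₀ (colourClasses (c ∘ Fin.suc))

module GraphFormula (G : Graph) (simple : IsSimple G) (bipartite : IsBipartite G) where

  open ColourClasses (colourClasses (proj₁ bipartite))

  F : CNF
  F = record { nv = a ; nc = b ; pos = λ y x → adj G (enum (inj₁ x)) (enum (inj₂ y)) ; neg = λ _ _ → false }

  monotone : Monotone F
  monotone _ _ = refl

  no-edge : ∀ {u v} → proj₁ bipartite u ≡ proj₁ bipartite v → adj G u v ≡ false
  no-edge same = ¬T⇒≡false λ uv → proj₂ bipartite _ _ uv same

  incAdj-enum : ∀ p q → incAdj F p q ≡ adj G (enum p) (enum q)
  incAdj-enum (inj₁ x) (inj₁ x′) = sym (no-edge (trans (colour₀ x) (sym (colour₀ x′))))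
  incAdj-enum (inj₁ x) (inj₂ y)  = ∨-identityʳ _
  incAdj-enum (inj₂ y) (inj₁ x)  = trans (∨-identityʳ _) (proj₁ simple _ _)
  incAdj-enum (inj₂ y) (inj₂ y′) = sym (no-edge (trans (colour₁ y) (sym (colour₁ y′))))

  incidence-iso : incidence F ≅ G
  incidence-iso = mk↔ₛ′ enum index enum-index index-enum ↔-∘ +↔⊎ ,
                  λ u v → incAdj-enum (splitAt a u) (splitAt a v)

-- Take a branch decomposition D of I(F) of PS-width p; its
-- relabelling to G has a cut with an induced matching of size ≥ k, which
-- pulls back to a cut of D whose ps-value is at most p.
mainTheorem13 : (G : Graph) → IsSimple G → IsBipartite G →
    Σ CNF λ F → Monotone F × (incidence F ≅ G) ×
      (∀ k p → IsMimw G k → IsPsw F p → 2 ^ k ≤ p * p)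
mainTheorem13 G simple bipartite = F , monotone , incidence-iso , bound
  where
  open GraphFormula G simple bipartite
  open Transfer (incidence F) G incidence-iso using (mapD; wideCut)

  bound : ∀ k p → IsMimw G k → IsPsw F p → 2 ^ k ≤ p * p
  bound k p (_ , mimw≥k) ((D , psw≡p) , _) with wideCut D k (mimw≥k (mapD D))
  ... | A , A∈D , m , k≤m , M = begin
      2 ^ k                                 ≤⟨ ^-monoʳ-≤ 2 k≤m ⟩
      2 ^ m                                 ≤⟨ clauseMatching-ps F monotone (memB A)
                                                 (clauseMatching F (memB A) monotone M) ⟩
      psCut F (memB A) * psCut F (memB A)   ≤⟨ *-mono-≤ cut≤p cut≤p ⟩
      p * p                                 ∎
    where
    open ≤-Reasoning
    cut≤p : psCut F (memB A) ≤ p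
    cut≤p = subst (psCut F (memB A) ≤_) psw≡p
      (≤-foldr-⊔ _ (∈-map⁺ (λ A → psCut F (memB A)) A∈D))
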